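{- Let $X\subseteq B^n$ with $s(X)\ge 1$. Then $s(X) = 1+\min\{\, s(X^{[i,j]}) \mid 1\le i<j\le n \,\}$.
   Context: $B=\{0,1\}$. A comparator $[i,j]$ ($i\ne j\in\{1,\dots,n\}$) maps $x\in B^n$ to $x^{[i,j]}$, obtained by replacing $x_i$ by $\min(x_i,x_j)$ and $x_j$ by $\max(x_i,x_j)$; an exchange $(i,j)$ swaps entries $i$ and $j$. For $X\subseteq B^n$, $X^{[i,j]}=\{x^{[i,j]}\mid x\in X\}$. A comparator network on $n$ channels is a finite sequence of comparators and exchanges applied left to right; its size is its number of comparators. For $X\subseteq B^n$, $s(X)$ is the minimal size of a comparator network whose output on every $x\in X$ is sorted (nondecreasing). -}

module Defs where

open import Data.Bool using (Bool; true; false; _∧_; _∨_) renaming (_≤_ to _≤ᵇ_)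
open import Data.Nat using (ℕ; zero; suc; _+_; _≤_; _<_)
open import Data.Fin using (Fin) renaming (_≤_ to _≤ᶠ_; _<_ to _<ᶠ_)
open import Data.Vec using (Vec; lookup; _[_]≔_)
open import Data.List using (List; []; _∷_)
open import Data.Product using (Σ; ∃; _×_; _,_)
open import Relation.Binary.PropositionalEquality using (_≡_; _≢_)

Word : ℕ → Set
Word n = Vec Bool n

Subset : ℕ → Set₁
Subset n = Word n → Set

cmp : ∀ {n} → Fin n → Fin n → Word n → Word n
cmp i j x = (x [ i ]≔ (lookup x i ∧ lookup x j)) [ j ]≔ (lookup x i ∨ lookup x j)

exch : ∀ {n} → Fin n → Fin n → Word n → Word n
exch i j x = (x [ i ]≔ lookup x j) [ j ]≔ lookup x i

_^[_,_] : ∀ {n} → Subset n → Fin n → Fin n → Subset n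
(X ^[ i , j ]) y = Σ (Word _) λ x → X x × cmp i j x ≡ y

data Gate (n : ℕ) : Set where
  comparator : (i j : Fin n) → i ≢ j → Gate n
  exchange   : (i j : Fin n) → i ≢ j → Gate n

Network : ℕ → Set
Network n = List (Gate n)

applyGate : ∀ {n} → Gate n → Word n → Word n
applyGate (comparator i j _) = cmp i j
applyGate (exchange i j _)   = exch i j

run : ∀ {n} → Network n → Word n → Word n
run []       x = x
run (g ∷ gs) x = run gs (applyGate g x)

size : ∀ {n} → Network n → ℕ
size []                      = zero
size (comparator _ _ _ ∷ gs) = suc (size gs)
size (exchange _ _ _ ∷ gs)   = size gs

Sorted : ∀ {n} → Word n → Set
Sorted x = ∀ i j → i ≤ᶠ j → lookup x i ≤ᵇ lookup x j

Sorts : ∀ {n} → Network n → Subset n → Set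
Sorts N X = ∀ x → X x → Sorted (run N x)

IsS : ∀ {n} → Subset n → ℕ → Set
IsS {n} X k = (Σ (Network n) λ N → Sorts N X × size N ≡ k)
            × (∀ (N : Network n) → Sorts N X → k ≤ size N)

-- A comparator [j,i] with j > i is [i,j] followed by the exchange (i,j), and an exchange
-- can be moved behind a comparator by relabelling the comparator's channels. So a network
-- with at least one comparator computes the same function as [i,j] (i < j) followed by a
-- network N' with one comparator less. For an optimal N, the network N' sorts X^[i,j]; and
-- prefixing [i,j] to any network sorting some X^[i',j'] yields one sorting X, so it is no
-- smaller than N'.
module Submission where

open import Defs
open import Data.Nat using (ℕ; suc; _≤_; _+_)
open import Data.Nat.Properties using (≤-pred)
open import Data.Fin using (Fin) renaming (_<_ to _<ᶠ_)
open import Data.Fin.Properties using (_≟_; <-cmp; <⇒≢)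
open import Data.Fin.Permutation.Components using (transpose; transpose-inverse)
open import Data.Bool using (_∧_; _∨_)
open import Data.Bool.Properties using (∧-comm; ∨-comm)
open import Data.Vec using (lookup; tabulate; _[_]≔_)
open import Data.Vec.Properties using (lookup∘update; lookup∘update′; tabulate∘lookup; tabulate-cong)
open import Data.List using (_∷_)
open import Data.Product using (Σ; _×_; _,_)
open import Data.Empty using (⊥-elim)
open import Function.Definitions using (Injective)
open import Relation.Nullary using (yes; no)
open import Relation.Binary.Definitions using (tri<; tri≈; tri>)
open import Relation.Binary.PropositionalEquality
  using (_≡_; _≢_; refl; sym; trans; cong; cong₂; subst; module ≡-Reasoning)

private
  variable
    n : ℕ

lookup-extensionality : {x y : Word n} → (∀ k → lookup x k ≡ lookup y k) → x ≡ y
lookup-extensionality {x = x} {y} eq = begin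
  x                    ≡⟨ tabulate∘lookup x ⟨
  tabulate (lookup x)  ≡⟨ tabulate-cong eq ⟩
  tabulate (lookup y)  ≡⟨ tabulate∘lookup y ⟩
  y                    ∎
  where open ≡-Reasoning

transpose-injective : (i j : Fin n) → Injective _≡_ _≡_ (transpose i j)
transpose-injective i j {k} {l} eq = begin
  k                                ≡⟨ transpose-inverse j i ⟨
  transpose j i (transpose i j k)  ≡⟨ cong (transpose j i) eq ⟩
  transpose j i (transpose i j l)  ≡⟨ transpose-inverse j i ⟩
  l                                ∎
  where open ≡-Reasoning

lookup-exch : (a b : Fin n) (x : Word n) (k : Fin n) →
              lookup (exch a b x) k ≡ lookup x (transpose a b k)
lookup-exch a b x k with k ≟ a
... | yes refl with k ≟ b
...   | yes refl = lookup∘update k (x [ k ]≔ lookup x k) (lookup x k)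
...   | no k≢b   = trans (lookup∘update′ k≢b (x [ k ]≔ lookup x b) (lookup x k)) (lookup∘update k x (lookup x b))
lookup-exch a b x k | no k≢a with k ≟ b
...   | yes refl = lookup∘update k (x [ a ]≔ lookup x k) (lookup x a)
...   | no k≢b   = trans (lookup∘update′ k≢b (x [ a ]≔ lookup x b) (lookup x a)) (lookup∘update′ k≢a x (lookup x b))

lookup-cmpˡ : {i j : Fin n} (x : Word n) → i ≢ j → lookup (cmp i j x) i ≡ (lookup x i ∧ lookup x j)
lookup-cmpˡ {i = i} {j} x i≢j =
  trans (lookup∘update′ i≢j (x [ i ]≔ (lookup x i ∧ lookup x j)) (lookup x i ∨ lookup x j))
        (lookup∘update i x (lookup x i ∧ lookup x j))

lookup-cmpʳ : {i j : Fin n} (x : Word n) → lookup (cmp i j x) j ≡ (lookup x i ∨ lookup x j)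
lookup-cmpʳ {i = i} {j} x = lookup∘update j (x [ i ]≔ (lookup x i ∧ lookup x j)) (lookup x i ∨ lookup x j)

lookup-cmp-other : {i j k : Fin n} (x : Word n) → k ≢ i → k ≢ j → lookup (cmp i j x) k ≡ lookup x k
lookup-cmp-other {i = i} {j} x k≢i k≢j =
  trans (lookup∘update′ k≢j (x [ i ]≔ (lookup x i ∧ lookup x j)) (lookup x i ∨ lookup x j))
        (lookup∘update′ k≢i x (lookup x i ∧ lookup x j))

lookup-cmp-relabel : (π : Fin n → Fin n) → Injective _≡_ _≡_ π → {i j : Fin n} → i ≢ j →
                     (x y : Word n) → (∀ k → lookup y k ≡ lookup x (π k)) →
                     ∀ k → lookup (cmp i j y) k ≡ lookup (cmp (π i) (π j) x) (π k)
lookup-cmp-relabel π π-inj {i} {j} i≢j x y y≡x∘π k with k ≟ j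
... | yes refl = begin
  lookup (cmp i k y) k                  ≡⟨ lookup-cmpʳ y ⟩
  lookup y i ∨ lookup y k               ≡⟨ cong₂ _∨_ (y≡x∘π i) (y≡x∘π k) ⟩
  lookup x (π i) ∨ lookup x (π k)       ≡⟨ lookup-cmpʳ x ⟨
  lookup (cmp (π i) (π k) x) (π k)      ∎
  where open ≡-Reasoning
... | no k≢j with k ≟ i
...   | yes refl = begin
  lookup (cmp k j y) k                  ≡⟨ lookup-cmpˡ y i≢j ⟩
  lookup y k ∧ lookup y j               ≡⟨ cong₂ _∧_ (y≡x∘π k) (y≡x∘π j) ⟩
  lookup x (π k) ∧ lookup x (π j)       ≡⟨ lookup-cmpˡ x (λ eq → i≢j (π-inj eq)) ⟨
  lookup (cmp (π k) (π j) x) (π k)      ∎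
  where open ≡-Reasoning
...   | no k≢i = begin
  lookup (cmp i j y) k                  ≡⟨ lookup-cmp-other y k≢i k≢j ⟩
  lookup y k                            ≡⟨ y≡x∘π k ⟩
  lookup x (π k)                        ≡⟨ lookup-cmp-other x (λ eq → k≢i (π-inj eq)) (λ eq → k≢j (π-inj eq)) ⟨
  lookup (cmp (π i) (π j) x) (π k)      ∎
  where open ≡-Reasoning

cmp∘exch : (a b : Fin n) {i j : Fin n} → i ≢ j → (x : Word n) →
           cmp i j (exch a b x) ≡ exch a b (cmp (transpose a b i) (transpose a b j) x)
cmp∘exch a b {i} {j} i≢j x = lookup-extensionality λ k →
  trans (lookup-cmp-relabel (transpose a b) (transpose-injective a b) i≢j x (exch a b x) (lookup-exch a b x) k)
        (sym (lookup-exch a b (cmp (transpose a b i) (transpose a b j) x) k))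

cmp-reverse : {i j : Fin n} → i ≢ j → (x : Word n) → cmp j i x ≡ exch j i (cmp i j x)
cmp-reverse {i = i} {j} i≢j x = lookup-extensionality λ k → trans (lookup-cmp-reverse k) (sym (lookup-exch j i (cmp i j x) k))
  where
  lookup-cmp-reverse : ∀ k → lookup (cmp j i x) k ≡ lookup (cmp i j x) (transpose j i k)
  lookup-cmp-reverse k with k ≟ j
  ... | yes refl = begin
    lookup (cmp k i x) k     ≡⟨ lookup-cmpˡ x (λ eq → i≢j (sym eq)) ⟩
    lookup x k ∧ lookup x i  ≡⟨ ∧-comm (lookup x k) (lookup x i) ⟩
    lookup x i ∧ lookup x k  ≡⟨ lookup-cmpˡ x i≢j ⟨
    lookup (cmp i k x) i     ∎
    where open ≡-Reasoning
  ... | no k≢j with k ≟ i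
  ...   | yes refl = begin
    lookup (cmp j k x) k     ≡⟨ lookup-cmpʳ x ⟩
    lookup x j ∨ lookup x k  ≡⟨ ∨-comm (lookup x j) (lookup x k) ⟩
    lookup x k ∨ lookup x j  ≡⟨ lookup-cmpʳ x ⟨
    lookup (cmp k j x) j     ∎
    where open ≡-Reasoning
  ...   | no k≢i = trans (lookup-cmp-other x k≢j k≢i) (sym (lookup-cmp-other x k≢i k≢j))

record ComparatorFirst (N : Network n) : Set where
  field
    first₁ first₂ : Fin n
    first₁<first₂ : first₁ <ᶠ first₂
    rest          : Network n
    size≡         : size N ≡ suc (size rest)
    run≡          : ∀ x → run N x ≡ run rest (cmp first₁ first₂ x)

comparatorFirst-resp : {N M : Network n} → size N ≡ size M → (∀ x → run N x ≡ run M x) →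
                       ComparatorFirst M → ComparatorFirst N
comparatorFirst-resp size-N≡M run-N≡M cf = record
  { first₁        = first₁
  ; first₂        = first₂
  ; first₁<first₂ = first₁<first₂
  ; rest          = rest
  ; size≡         = trans size-N≡M size≡
  ; run≡          = λ x → trans (run-N≡M x) (run≡ x)
  }
  where open ComparatorFirst cf

comparatorFirst-∷ : {i j : Fin n} (i≢j : i ≢ j) (M : Network n) → ComparatorFirst (comparator i j i≢j ∷ M)
comparatorFirst-∷ {i = i} {j} i≢j M with <-cmp i j
... | tri< i<j _ _ = record
  { first₁        = i
  ; first₂        = j
  ; first₁<first₂ = i<j
  ; rest          = M
  ; size≡         = refl
  ; run≡          = λ x → refl
  }
... | tri≈ _ i≡j _ = ⊥-elim (i≢j i≡j)
... | tri> _ _ j<i = record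
  { first₁        = j
  ; first₂        = i
  ; first₁<first₂ = j<i
  ; rest          = exchange i j i≢j ∷ M
  ; size≡         = refl
  ; run≡          = λ x → cong (run M) (cmp-reverse (λ eq → i≢j (sym eq)) x)
  }

comparatorFirst : (N : Network n) → 1 ≤ size N → ComparatorFirst N
comparatorFirst (comparator i j i≢j ∷ M) _ = comparatorFirst-∷ i≢j M
comparatorFirst (exchange a b a≢b ∷ M) 1≤size with comparatorFirst M 1≤size
... | record { first₁ = i ; first₂ = j ; first₁<first₂ = i<j ; rest = M' ; size≡ = size≡ ; run≡ = run≡ } =
  comparatorFirst-resp size≡
    (λ x → trans (run≡ (exch a b x)) (cong (run M') (cmp∘exch a b i≢j x)))
    (comparatorFirst-∷ (λ eq → i≢j (transpose-injective a b eq)) (exchange a b a≢b ∷ M'))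
  where
  i≢j : i ≢ j
  i≢j = <⇒≢ i<j

sorts-image : {N M : Network n} {X : Subset n} {i j : Fin n} →
              (∀ x → run N x ≡ run M (cmp i j x)) → Sorts N X → Sorts M (X ^[ i , j ])
sorts-image run≡ N-sorts _ (x , x∈X , refl) = subst Sorted (run≡ x) (N-sorts x x∈X)

isS-≤-suc-image : {X : Subset n} {k : ℕ} → IsS X k → {i j : Fin n} → i ≢ j →
                  (M : Network n) → Sorts M (X ^[ i , j ]) → k ≤ suc (size M)
isS-≤-suc-image (_ , k-minimal) i≢j M M-sorts =
  k-minimal (comparator _ _ i≢j ∷ M) (λ x x∈X → M-sorts (cmp _ _ x) (x , x∈X , refl))

mainTheorem6 : ∀ (n : ℕ) (X : Subset n) (k : ℕ) → IsS X k → 1 ≤ k →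
    Σ ℕ (λ m → (k ≡ 1 + m)
    × (Σ (Fin n) λ i → Σ (Fin n) λ j → (i <ᶠ j) × IsS (X ^[ i , j ]) m)
    × (∀ (i j : Fin n) → i <ᶠ j → ∀ (m' : ℕ) → IsS (X ^[ i , j ]) m' → m ≤ m'))
mainTheorem6 n X k isS@((N , N-sorts , size-N) , _) 1≤k =
  size rest , k≡1+m , (first₁ , first₂ , first₁<first₂ , rest-isS) , rest-minimal
  where
  open ComparatorFirst (comparatorFirst N (subst (1 ≤_) (sym size-N) 1≤k))

  k≡1+m : k ≡ 1 + size rest
  k≡1+m = trans (sym size-N) size≡

  rest-optimal : {i j : Fin n} → i <ᶠ j → (M : Network n) → Sorts M (X ^[ i , j ]) → size rest ≤ size M
  rest-optimal i<j M M-sorts = ≤-pred (subst (_≤ suc (size M)) k≡1+m (isS-≤-suc-image isS (<⇒≢ i<j) M M-sorts))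

  rest-isS : IsS (X ^[ first₁ , first₂ ]) (size rest)
  rest-isS = (rest , sorts-image {N = N} {M = rest} run≡ N-sorts , refl) , rest-optimal first₁<first₂

  rest-minimal : ∀ (i j : Fin n) → i <ᶠ j → ∀ (m' : ℕ) → IsS (X ^[ i , j ]) m' → size rest ≤ m'
  rest-minimal i j i<j m' ((M , M-sorts , refl) , _) = rest-optimal i<j M M-sorts
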